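{- For every odd integer $n\ge 7$, the complete graph $K_n$ admits an edge-friendly labeling $f$ such that no vertex of $K_n$ is unlabeled under the induced partial vertex labeling $f^+$; that is, $K_n$ is opinionated.
   Context: An edge labeling of a graph $G=(V,E)$ is a function $f:E\to\{0,1\}$; write $e_f(i)=|\{uv\in E: f(uv)=i\}|$. The labeling $f$ is edge-friendly if $|e_f(0)-e_f(1)|\le 1$. For a vertex $v$, let $N_i(v)=\{u\in V: uv\in E,\ f(uv)=i\}$. The induced partial vertex labeling $f^+$ is defined by $f^+(v)=0$ if $|N_0(v)|>|N_1(v)|$, $f^+(v)=1$ if $|N_0(v)|<|N_1(v)|$, and $v$ is called unlabeled if $|N_0(v)|=|N_1(v)|$. An edge-friendly labeling with no unlabeled vertices is called opinionated, and a graph admitting one is called opinionated. -}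

module Defs where

open import Data.Nat using (ℕ; zero; suc; _+_; _≤_; _<_)
open import Data.Fin using (Fin; toℕ)
open import Data.Bool using (Bool; true; false; _∧_; if_then_else_)
open import Data.List using (List; filter; length; allFin)
open import Data.Product using (Σ; _×_; _,_)
open import Relation.Binary.PropositionalEquality using (_≡_)
open import Relation.Nullary using (¬_)
open import Data.Fin using (_<?_)
open import Data.Bool using (T)
open import Relation.Nullary.Decidable using (⌊_⌋)
open import Data.Bool.Properties using (T?)

record Graph (n : ℕ) : Set where
  field
    adj    : Fin n → Fin n → Bool
    adj-sym    : ∀ u v → adj u v ≡ adj v u
    adj-irrefl : ∀ v → adj v v ≡ false
open Graph public

K : (n : ℕ) → Graph n
K n = record { adj = λ u v → ⌊ u Data.Fin.≟ v ⌋ Data.Bool.xor true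
             ; adj-sym = symK ; adj-irrefl = irrK }
  where
  open import Relation.Nullary using (yes; no)
  open import Relation.Binary.PropositionalEquality using (refl; sym)
  symK : ∀ u v → (⌊ u Data.Fin.≟ v ⌋ Data.Bool.xor true) ≡ (⌊ v Data.Fin.≟ u ⌋ Data.Bool.xor true)
  symK u v with u Data.Fin.≟ v | v Data.Fin.≟ u
  ... | yes _ | yes _ = refl
  ... | no _  | no _  = refl
  ... | yes p | no q  = Relation.Nullary.contradiction (sym p) q
  ... | no p  | yes q = Relation.Nullary.contradiction (sym q) p
  irrK : ∀ v → (⌊ v Data.Fin.≟ v ⌋ Data.Bool.xor true) ≡ false
  irrK v with v Data.Fin.≟ v
  ... | yes _ = refl
  ... | no p  = Relation.Nullary.contradiction refl p

-- An edge labeling f : E → {0,1}. An edge uv is an unordered pair, so a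
-- labeling is a symmetric function on pairs of vertices (false = 0, true = 1);
-- only its values on edges matter.
record EdgeLabeling {n : ℕ} (G : Graph n) : Set where
  field
    lab     : Fin n → Fin n → Bool
    lab-sym : ∀ u v → lab u v ≡ lab v u
open EdgeLabeling public

-- e_f(i): number of edges uv (counted once, as u < v) with f(uv) = i.
eCount : ∀ {n} {G : Graph n} → EdgeLabeling G → Bool → ℕ
eCount {n} {G} f i =
  length (filter (λ p → T? (isEdgeWith (Data.Product.proj₁ p) (Data.Product.proj₂ p)))
                 (Data.List.cartesianProduct (allFin n) (allFin n)))
  where
  isEdgeWith : Fin n → Fin n → Bool
  isEdgeWith u v = ⌊ u <? v ⌋ ∧ adj G u v ∧ ⌊ lab f u v Data.Bool.≟ i ⌋

nbCount : ∀ {n} {G : Graph n} → EdgeLabeling G → Fin n → Bool → ℕ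
nbCount {n} {G} f v i =
  length (filter (λ u → T? (adj G v u ∧ ⌊ lab f v u Data.Bool.≟ i ⌋)) (allFin n))

-- Edge-friendly: |e_f(0) - e_f(1)| ≤ 1.
EdgeFriendly : ∀ {n} {G : Graph n} → EdgeLabeling G → Set
EdgeFriendly f = eCount f false ≤ suc (eCount f true) × eCount f true ≤ suc (eCount f false)

-- v is unlabeled under f⁺ iff |N_0(v)| = |N_1(v)|.
Unlabeled : ∀ {n} {G : Graph n} → EdgeLabeling G → Fin n → Set
Unlabeled f v = nbCount f v false ≡ nbCount f v true

OpinionatedLabeling : ∀ {n} {G : Graph n} → EdgeLabeling G → Set
OpinionatedLabeling f = EdgeFriendly f × (∀ v → ¬ Unlabeled f v)

Opinionated : ∀ {n} → Graph n → Set
Opinionated G = Σ (EdgeLabeling G) OpinionatedLabeling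

module Submission where

-- The proof is by induction on n in steps of two. Given an opinionated
-- labeling of K_n (n ≥ 2), add two new vertices a and b: every edge from a
-- to an old vertex gets label 0, every edge from b to an old vertex gets
-- label 1, and the edge ab gets whichever label is currently in the
-- minority. Each old vertex gains one neighbour of each label, so it keeps
-- its opinion; a sees n ≥ 2 edges labeled 0 and at most one labeled 1
-- (symmetrically for b); and both label classes grow by n, plus one for the
-- edge ab, which keeps the labeling edge-friendly. The induction starts at
-- an explicit opinionated labeling of K_7, verified by computation.

open import Defs
open import Data.Nat using (ℕ; zero; suc; _+_; _≤_; _<_; _%_; z≤n; s≤s; _≤?_)
open import Data.Nat.Properties
  using (+-assoc; +-identityʳ; +-suc; +-monoʳ-≤; +-monoʳ-<; ≤-trans; ≤-reflexive; n≤1+n; ≰⇒>;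
         suc-injective; m≤n⇒∃[o]m+o≡n)
  renaming (_≟_ to _≟ℕ_)
open import Data.Fin using (Fin; zero; suc; toℕ; _<?_) renaming (_≟_ to _≟ᶠ_)
open import Data.Fin.Properties using (all?) renaming (suc-injective to suc-injectiveᶠ)
open import Data.Bool using (Bool; true; false; _∧_; _∨_; _xor_; if_then_else_) renaming (_≟_ to _≟ᵇ_)
open import Data.Bool.Properties using (T?; ∨-comm)
open import Data.List using (List; _++_; filter; length; map; tabulate; cartesianProduct)
open import Data.List.Properties using (filter-++; length-++; map-tabulate)
open import Data.Product using (Σ; _×_; _,_; proj₁; proj₂)
open import Function using (_∘_; id)
open import Relation.Binary.PropositionalEquality
  using (_≡_; _≢_; refl; sym; trans; cong; cong₂; subst₂; module ≡-Reasoning)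
open import Relation.Nullary using (¬_; Dec; yes; no)
open import Relation.Nullary.Decidable using (⌊_⌋; ⌊⌋-map′; toWitness; ¬?; _×-dec_)

ind : Bool → ℕ
ind b = if b then 1 else 0

count : ∀ {k} → (Fin k → Bool) → ℕ
count {zero}  p = 0
count {suc k} p = ind (p zero) + count (p ∘ suc)

total : ∀ {k} → (Fin k → ℕ) → ℕ
total {zero}  g = 0
total {suc k} g = g zero + total (g ∘ suc)

count-cong : ∀ {k} {p q : Fin k → Bool} → (∀ u → p u ≡ q u) → count p ≡ count q
count-cong {zero}  p≗q = refl
count-cong {suc k} p≗q = cong₂ _+_ (cong ind (p≗q zero)) (count-cong (p≗q ∘ suc))

total-cong : ∀ {k} {g h : Fin k → ℕ} → (∀ u → g u ≡ h u) → total g ≡ total h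
total-cong {zero}  g≗h = refl
total-cong {suc k} g≗h = cong₂ _+_ (g≗h zero) (total-cong (g≗h ∘ suc))

count-true : ∀ k → count {k} (λ _ → true) ≡ k
count-true zero    = refl
count-true (suc k) = cong suc (count-true k)

count-false : ∀ k → count {k} (λ _ → false) ≡ 0
count-false zero    = refl
count-false (suc k) = count-false k

length-filter-tabulate : ∀ {A : Set} {k} (q : A → Bool) (g : Fin k → A) →
  length (filter (T? ∘ q) (tabulate g)) ≡ count (q ∘ g)
length-filter-tabulate {k = zero}  q g = refl
length-filter-tabulate {k = suc k} q g with q (g zero) | length-filter-tabulate q (g ∘ suc)
... | true  | rest = cong suc rest
... | false | rest = rest

length-filter-cartesian : ∀ {A B : Set} {k} (q : A × B → Bool) (g : Fin k → A) (ys : List B) →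
  length (filter (T? ∘ q) (cartesianProduct (tabulate g) ys))
    ≡ total (λ u → length (filter (T? ∘ q) (map (g u ,_) ys)))
length-filter-cartesian {k = zero}  q g ys = refl
length-filter-cartesian {A} {B} {suc k} q g ys = begin
    length (filter (T? ∘ q) (row ++ rows))
  ≡⟨ cong length (filter-++ (T? ∘ q) row rows) ⟩
    length (filter (T? ∘ q) row ++ filter (T? ∘ q) rows)
  ≡⟨ length-++ (filter (T? ∘ q) row) ⟩
    length (filter (T? ∘ q) row) + length (filter (T? ∘ q) rows)
  ≡⟨ cong (length (filter (T? ∘ q) row) +_) (length-filter-cartesian q (g ∘ suc) ys) ⟩
    total (λ u → length (filter (T? ∘ q) (map (g u ,_) ys)))
  ∎
  where
  open ≡-Reasoning
  row rows : List (A × B)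
  row  = map (g zero ,_) ys
  rows = cartesianProduct (tabulate (g ∘ suc)) ys

degree : ∀ {n} → (Fin n → Fin n → Bool) → Fin n → Bool → ℕ
degree {n} L v i = count (λ u → adj (K n) v u ∧ ⌊ L v u ≟ᵇ i ⌋)

edges : ∀ {n} → (Fin n → Fin n → Bool) → Bool → ℕ
edges {n} L i = total (λ u → count (λ v → ⌊ u <? v ⌋ ∧ adj (K n) u v ∧ ⌊ L u v ≟ᵇ i ⌋))

nbCount≡degree : ∀ {n} (f : EdgeLabeling (K n)) v i → nbCount f v i ≡ degree (lab f) v i
nbCount≡degree {n} f v i = length-filter-tabulate (λ u → adj (K n) v u ∧ ⌊ lab f v u ≟ᵇ i ⌋) id

eCount≡edges : ∀ {n} (f : EdgeLabeling (K n)) i → eCount f i ≡ edges (lab f) i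
eCount≡edges {n} f i = trans (length-filter-cartesian q id (tabulate id)) (total-cong rowCount)
  where
  q : Fin n × Fin n → Bool
  q (u , v) = ⌊ u <? v ⌋ ∧ adj (K n) u v ∧ ⌊ lab f u v ≟ᵇ i ⌋
  rowCount : ∀ u → length (filter (T? ∘ q) (map (u ,_) (tabulate id)))
                     ≡ count (λ v → q (u , v))
  rowCount u = trans (cong (length ∘ filter (T? ∘ q)) (map-tabulate id (u ,_)))
                     (length-filter-tabulate q (u ,_))

Split : ∀ {n} → (Fin n → Fin n → Bool) → Fin n → Set
Split L v = degree L v false ≡ degree L v true

unlabeled⇒split : ∀ {n} (f : EdgeLabeling (K n)) v → Unlabeled f v → Split (lab f) v
unlabeled⇒split f v eq = trans (sym (nbCount≡degree f v false)) (trans eq (nbCount≡degree f v true))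

split⇒unlabeled : ∀ {n} (f : EdgeLabeling (K n)) v → Split (lab f) v → Unlabeled f v
split⇒unlabeled f v eq = trans (nbCount≡degree f v false) (trans eq (sym (nbCount≡degree f v true)))

Balanced : ℕ → ℕ → Set
Balanced a b = a ≤ suc b × b ≤ suc a

balanced-+ : ∀ n {a b} → Balanced a b → Balanced (n + a) (n + b)
balanced-+ n {a} {b} (a≤1+b , b≤1+a) =
  ≤-trans (+-monoʳ-≤ n a≤1+b) (≤-reflexive (+-suc n b)) ,
  ≤-trans (+-monoʳ-≤ n b≤1+a) (≤-reflexive (+-suc n a))

balanced-sucʳ : ∀ {a b} → Balanced a b → b ≤ a → Balanced a (suc b)
balanced-sucʳ (a≤1+b , _) b≤a = ≤-trans a≤1+b (n≤1+n _) , s≤s b≤a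

balanced-sucˡ : ∀ {a b} → Balanced a b → a < b → Balanced (suc a) b
balanced-sucˡ (_ , b≤1+a) a<b = ≤-trans a<b (n≤1+n _) , ≤-trans b≤1+a (n≤1+n _)

-- Both classes grow by n and the extra edge goes to the minority label x.
rebalance : ∀ n {a b} → Balanced a b →
  Σ Bool λ x → Balanced (ind ⌊ x ≟ᵇ false ⌋ + (n + a)) (ind ⌊ x ≟ᵇ true ⌋ + (n + b))
rebalance n {a} {b} bal with b ≤? a
... | yes b≤a = true  , balanced-sucʳ (balanced-+ n bal) (+-monoʳ-≤ n b≤a)
... | no  b≰a = false , balanced-sucˡ (balanced-+ n bal) (+-monoʳ-< n (≰⇒> b≰a))

-- In Fin (2 + n) the new vertices are zero and
-- suc zero, and old vertex w becomes suc (suc w).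
extend : ∀ {n} → Bool → (Fin n → Fin n → Bool) → Fin (2 + n) → Fin (2 + n) → Bool
extend x L zero          (suc zero)    = x
extend x L (suc zero)    zero          = x
extend x L (suc zero)    (suc (suc _)) = true
extend x L (suc (suc _)) (suc zero)    = true
extend x L (suc (suc u)) (suc (suc w)) = L u w
extend x L _             _             = false

extend-sym : ∀ {n} x (L : Fin n → Fin n → Bool) → (∀ u v → L u v ≡ L v u) →
  ∀ u v → extend x L u v ≡ extend x L v u
extend-sym x L sym-L zero          zero          = refl
extend-sym x L sym-L zero          (suc zero)    = refl
extend-sym x L sym-L zero          (suc (suc _)) = refl
extend-sym x L sym-L (suc zero)    zero          = refl
extend-sym x L sym-L (suc zero)    (suc zero)    = refl
extend-sym x L sym-L (suc zero)    (suc (suc _)) = refl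
extend-sym x L sym-L (suc (suc _)) zero          = refl
extend-sym x L sym-L (suc (suc _)) (suc zero)    = refl
extend-sym x L sym-L (suc (suc u)) (suc (suc w)) = sym-L u w

extendLabeling : ∀ {n} → Bool → EdgeLabeling (K n) → EdgeLabeling (K (2 + n))
extendLabeling x f = record { lab = extend x (lab f) ; lab-sym = extend-sym x (lab f) (lab-sym f) }

adj-shift : ∀ {n} (u w : Fin n) → adj (K (2 + n)) (suc (suc u)) (suc (suc w)) ≡ adj (K n) u w
adj-shift u w = cong (_xor true)
  (trans (⌊⌋-map′ (cong suc) suc-injectiveᶠ (suc u ≟ᶠ suc w)) (⌊⌋-map′ (cong suc) suc-injectiveᶠ (u ≟ᶠ w)))

<-shift : ∀ {n} (u w : Fin n) → ⌊ suc (suc u) <? suc (suc w) ⌋ ≡ ⌊ u <? w ⌋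
<-shift u w = trans (⌊⌋-map′ _ _ _) (sym (⌊⌋-map′ _ _ _))

degree-old : ∀ {n} x (L : Fin n → Fin n → Bool) w i →
  degree (extend x L) (suc (suc w)) i ≡ ind ⌊ false ≟ᵇ i ⌋ + (ind ⌊ true ≟ᵇ i ⌋ + degree L w i)
degree-old x L w i =
  cong (λ d → ind ⌊ false ≟ᵇ i ⌋ + (ind ⌊ true ≟ᵇ i ⌋ + d))
       (count-cong (λ u → cong (_∧ ⌊ L w u ≟ᵇ i ⌋) (adj-shift w u)))

degree-zero : ∀ {n} x (L : Fin n → Fin n → Bool) →
  degree (extend x L) zero false ≡ ind ⌊ x ≟ᵇ false ⌋ + n ×
  degree (extend x L) zero true  ≡ ind ⌊ x ≟ᵇ true ⌋ + 0
degree-zero {n} x L = cong (ind ⌊ x ≟ᵇ false ⌋ +_) (count-true n) , cong (ind ⌊ x ≟ᵇ true ⌋ +_) (count-false n)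

degree-one : ∀ {n} x (L : Fin n → Fin n → Bool) →
  degree (extend x L) (suc zero) false ≡ ind ⌊ x ≟ᵇ false ⌋ + 0 ×
  degree (extend x L) (suc zero) true  ≡ ind ⌊ x ≟ᵇ true ⌋ + n
degree-one {n} x L = cong (ind ⌊ x ≟ᵇ false ⌋ +_) (count-false n) , cong (ind ⌊ x ≟ᵇ true ⌋ +_) (count-true n)

unbalanced-new : ∀ {n} → 2 ≤ n → ∀ b c → ind b + n ≢ ind c + 0
unbalanced-new (s≤s (s≤s _)) false false ()
unbalanced-new (s≤s (s≤s _)) false true  ()
unbalanced-new (s≤s (s≤s _)) true  false ()
unbalanced-new (s≤s (s≤s _)) true  true  ()

extend-splits-none : ∀ {n} → 2 ≤ n → ∀ x (L : Fin n → Fin n → Bool) →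
  (∀ w → ¬ Split L w) → ∀ v → ¬ Split (extend x L) v
extend-splits-none 2≤n x L none zero split =
  let (deg₀ , deg₁) = degree-zero x L
  in unbalanced-new 2≤n _ _ (trans (sym deg₀) (trans split deg₁))
extend-splits-none 2≤n x L none (suc zero) split =
  let (deg₀ , deg₁) = degree-one x L
  in unbalanced-new 2≤n _ _ (sym (trans (sym deg₀) (trans split deg₁)))
extend-splits-none 2≤n x L none (suc (suc w)) split =
  none w (suc-injective (trans (sym (degree-old x L w false)) (trans split (degree-old x L w true))))

-- Row by row: zero contributes the new edge and n edges labeled false,
-- suc zero contributes n edges labeled true, and the old rows are those of L.
edges-extend : ∀ {n} x (L : Fin n → Fin n → Bool) i →
  edges (extend x L) i
    ≡ (ind ⌊ x ≟ᵇ i ⌋ + count {n} (λ _ → ⌊ false ≟ᵇ i ⌋))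
      + (count {n} (λ _ → ⌊ true ≟ᵇ i ⌋) + edges L i)
edges-extend {n} x L i =
  cong (λ e → (ind ⌊ x ≟ᵇ i ⌋ + count {n} (λ _ → ⌊ false ≟ᵇ i ⌋)) + (count {n} (λ _ → ⌊ true ≟ᵇ i ⌋) + e))
       (total-cong λ u → count-cong λ w →
          cong₂ (λ lt a → lt ∧ a ∧ ⌊ L u w ≟ᵇ i ⌋) (<-shift u w) (adj-shift u w))

edges-extend-false : ∀ {n} x (L : Fin n → Fin n → Bool) →
  edges (extend x L) false ≡ ind ⌊ x ≟ᵇ false ⌋ + (n + edges L false)
edges-extend-false {n} x L = begin
    edges (extend x L) false
  ≡⟨ edges-extend x L false ⟩
    (ind ⌊ x ≟ᵇ false ⌋ + count {n} (λ _ → true)) + (count {n} (λ _ → false) + edges L false)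
  ≡⟨ cong₂ (λ c d → (ind ⌊ x ≟ᵇ false ⌋ + c) + (d + edges L false)) (count-true n) (count-false n) ⟩
    (ind ⌊ x ≟ᵇ false ⌋ + n) + edges L false
  ≡⟨ +-assoc (ind ⌊ x ≟ᵇ false ⌋) n (edges L false) ⟩
    ind ⌊ x ≟ᵇ false ⌋ + (n + edges L false)
  ∎
  where open ≡-Reasoning

edges-extend-true : ∀ {n} x (L : Fin n → Fin n → Bool) →
  edges (extend x L) true ≡ ind ⌊ x ≟ᵇ true ⌋ + (n + edges L true)
edges-extend-true {n} x L = begin
    edges (extend x L) true
  ≡⟨ edges-extend x L true ⟩
    (ind ⌊ x ≟ᵇ true ⌋ + count {n} (λ _ → false)) + (count {n} (λ _ → true) + edges L true)
  ≡⟨ cong₂ (λ c d → (ind ⌊ x ≟ᵇ true ⌋ + c) + (d + edges L true)) (count-false n) (count-true n) ⟩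
    (ind ⌊ x ≟ᵇ true ⌋ + 0) + (n + edges L true)
  ≡⟨ cong (_+ (n + edges L true)) (+-identityʳ (ind ⌊ x ≟ᵇ true ⌋)) ⟩
    ind ⌊ x ≟ᵇ true ⌋ + (n + edges L true)
  ∎
  where open ≡-Reasoning

extend-opinionated : ∀ {n} → 2 ≤ n → Opinionated (K n) → Opinionated (K (2 + n))
extend-opinionated {n} 2≤n (f , friendly , noneUnlabeled) = g , friendly′ , noneUnlabeled′
  where
  balanced : Balanced (edges (lab f) false) (edges (lab f) true)
  balanced = subst₂ Balanced (eCount≡edges f false) (eCount≡edges f true) friendly

  x : Bool
  x = proj₁ (rebalance n balanced)

  g : EdgeLabeling (K (2 + n))
  g = extendLabeling x f

  friendly′ : EdgeFriendly g
  friendly′ = subst₂ Balanced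
    (sym (trans (eCount≡edges g false) (edges-extend-false x (lab f))))
    (sym (trans (eCount≡edges g true)  (edges-extend-true  x (lab f))))
    (proj₂ (rebalance n balanced))

  noneUnlabeled′ : ∀ v → ¬ Unlabeled g v
  noneUnlabeled′ v unlabeled =
    extend-splits-none 2≤n x (lab f)
      (λ w split → noneUnlabeled w (split⇒unlabeled f w split))
      v (unlabeled⇒split g v unlabeled)

opinionated? : ∀ {n} {G : Graph n} (f : EdgeLabeling G) → Dec (OpinionatedLabeling f)
opinionated? f =
  ((eCount f false ≤? suc (eCount f true)) ×-dec (eCount f true ≤? suc (eCount f false)))
  ×-dec all? (λ v → ¬? (nbCount f v false ≟ℕ nbCount f v true))

-- The base case: the edges of K_7 labeled 1 (listed with smaller endpoint
-- first); the other 11 edges are labeled 0.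
labeledOne : ℕ → ℕ → Bool
labeledOne 0 2 = true
labeledOne 0 3 = true
labeledOne 1 4 = true
labeledOne 1 6 = true
labeledOne 2 3 = true
labeledOne 3 4 = true
labeledOne 3 6 = true
labeledOne 4 5 = true
labeledOne 4 6 = true
labeledOne 5 6 = true
labeledOne _ _ = false

K₇-labeling : EdgeLabeling (K 7)
K₇-labeling = record
  { lab     = λ u v → labeledOne (toℕ u) (toℕ v) ∨ labeledOne (toℕ v) (toℕ u)
  ; lab-sym = λ u v → ∨-comm (labeledOne (toℕ u) (toℕ v)) (labeledOne (toℕ v) (toℕ u))
  }

K₇-opinionated : Opinionated (K 7)
K₇-opinionated = K₇-labeling , toWitness {a? = opinionated? K₇-labeling} _

opinionated-odd : ∀ m → (7 + m) % 2 ≡ 1 → Opinionated (K (7 + m))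
opinionated-odd zero          odd = K₇-opinionated
opinionated-odd (suc zero)    ()
opinionated-odd (suc (suc m)) odd =
  extend-opinionated (s≤s (s≤s z≤n)) (opinionated-odd m odd)

mainTheorem2 : ∀ (n : ℕ) → n % 2 ≡ 1 → 7 ≤ n → Opinionated (K n)
mainTheorem2 n odd 7≤n with m≤n⇒∃[o]m+o≡n 7≤n
... | m , refl = opinionated-odd m odd
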